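{- Let $G_0$ be a finite graph and let $V(G_0)=C\cup I$ be a partition of its vertex set. If $H$ is a minimal forbidden induced subgraph of $\mathcal{G}(G_0;C,I)$, then the order of $H$ is at most $4|C||I|+2|C|+2|I|+1$. In particular, $\mathcal{G}(G_0;C,I)=\mathrm{Forb}(\mathcal{F})$ for a finite set $\mathcal{F}$ of graphs.
   Context: All graphs are finite and simple. For a graph $G_0$ and a partition $V(G_0)=C\cup I$, $\mathcal{G}(G_0;C,I)$ denotes the class of all graphs (up to isomorphism) obtained from $G_0$ by replacing every vertex $u\in C$ by a possibly empty clique $C_u$ and every vertex $u\in I$ by a possibly empty independent set $I_u$, where for distinct $u,v\in V(G_0)$ every vertex of the set replacing $u$ is adjacent to every vertex of the set replacing $v$ if $uv\in E(G_0)$, and there are no edges between these sets otherwise. This class is hereditary (closed under induced subgraphs). A minimal forbidden induced subgraph of a hereditary class $\mathcal{C}$ is a graph $H\notin\mathcal{C}$ all of whose proper induced subgraphs belong to $\mathcal{C}$. For a set of graphs $\mathcal{F}$, $\mathrm{Forb}(\mathcal{F})$ is the class of graphs containing no member of $\mathcal{F}$ as an induced subgraph. -}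

module Defs where

open import Data.Nat using (ℕ; zero; suc; _+_; _*_; _≤_; _<_)
open import Data.Fin using (Fin; zero; suc)
open import Data.Bool using (Bool; true; false; not)
open import Data.Product using (Σ; _×_; _,_)
open import Data.List using (List)
open import Data.List.Relation.Unary.All using (All)
open import Relation.Binary.PropositionalEquality using (_≡_; _≢_)
open import Relation.Nullary using (¬_)
open import Function.Definitions using (Injective)
open import Function.Bundles using (_⇔_)

record Graph : Set where
  field
    order : ℕ
    adj   : Fin order → Fin order → Bool
    sym   : ∀ u v → adj u v ≡ adj v u
    irr   : ∀ u → adj u u ≡ false
open Graph public

record _≼_ (H G : Graph) : Set where
  field
    emb     : Fin (order H) → Fin (order G)
    emb-inj : Injective _≡_ _≡_ emb
    emb-adj : ∀ u v → adj H u v ≡ adj G (emb u) (emb v)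

-- A partition V(G0) = C ∪ I is given by a colouring inC : V(G0) → Bool,
-- with C = {u | inC u ≡ true} and I = {u | inC u ≡ false}.
-- G ∈ 𝒢(G0;C,I) iff there is a map φ : V(G) → V(G0) (φ⁻¹(u) is the set
-- replacing u) such that distinct vertices x,y of G with φ x = φ y are
-- adjacent iff φ x ∈ C, and those with φ x ≠ φ y are adjacent iff
-- φ x φ y is an edge of G0.
record InClass (G0 : Graph) (inC : Fin (order G0) → Bool) (G : Graph) : Set where
  field
    φ       : Fin (order G) → Fin (order G0)
    same    : ∀ x y → x ≢ y → φ x ≡ φ y → adj G x y ≡ inC (φ x)
    differ  : ∀ x y → φ x ≢ φ y → adj G x y ≡ adj G0 (φ x) (φ y)

record MinimalForbidden (G0 : Graph) (inC : Fin (order G0) → Bool) (H : Graph) : Set where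
  field
    notIn    : ¬ InClass G0 inC H
    properIn : ∀ (H' : Graph) → H' ≼ H → order H' < order H → InClass G0 inC H'

count : ∀ {n} → (Fin n → Bool) → Bool → ℕ
count {zero}  f b = 0
count {suc n} f true  with f zero
... | true  = suc (count (λ i → f (suc i)) true)
... | false = count (λ i → f (suc i)) true
count {suc n} f false with f zero
... | true  = count (λ i → f (suc i)) false
... | false = suc (count (λ i → f (suc i)) false)

Forb : List Graph → Graph → Set
Forb 𝓕 G = All (λ F → ¬ (F ≼ G)) 𝓕

module Submission where

-- Call H critical if H ∉ 𝒢 but H ∖ x ∈ 𝒢 for every vertex x; minimal forbidden
-- graphs are critical.  For each x a model of H ∖ x extends to a labelling Φₓ of H
-- that is correct on all pairs avoiding x.  Two facts about twins x ≠ y (vertices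
-- with the same neighbours outside {x, y}) drive the bound:
--   (1) inC (Φₓ y) ≠ adj x y, since otherwise x can join the bag of y, giving H ∈ 𝒢;
--   (2) hence Φₓ separates y from every z with adj x z = adj x y.
-- Fix a vertex v.  Vertices a ≠ v with equal key (Φᵥ a, adj v a) are pairwise twins.
-- Inside a key class choose a representative r; every other member a is tagged by
-- Φᵣ a, whose colour is opposite to that of Φᵥ a by (1), and distinct members get
-- distinct tags by (2).  Counting the possible codes (key, tag) gives
--   |H| ≤ 1 + Σ_u 2 (1 + #vertices of G0 of the colour opposite to u) = 4|C||I| + 2|C| + 2|I| + 1.
-- For the finite basis, membership in 𝒢 is decidable (enumerate all labellings);
-- 𝓕 lists the graphs on at most that many vertices outside 𝒢, and a graph avoiding
-- 𝓕 lies in 𝒢 by induction on its order, since otherwise it would be critical.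

open import Defs hiding (sym)
open import Data.Nat using (ℕ; zero; suc; _+_; _*_; _≤_; _<_; z≤n; s≤s; pred)
import Data.Nat.Properties as ℕ
open import Data.Nat.Tactic.RingSolver using (solve-∀)
open import Data.Fin using (Fin; zero; suc; punchIn; punchOut; _≟_; _<?_)
open import Data.Fin.Properties
  using (punchIn-injective; punchIn-punchOut; punchOut-cong; injective⇒≤; toℕ<n;
         any?; all?; <-asym; <-irrefl; <-cmp)
open import Data.Bool using (Bool; true; false; not)
import Data.Bool.Properties as Bool
open import Data.Product using (Σ; ∃; _×_; _,_; proj₁; proj₂)
import Data.Product.Properties as Product
open import Data.Sum using (_⊎_; inj₁; inj₂)
open import Data.Maybe using (Maybe; just; nothing)
open import Data.Maybe.Properties using (just-injective)
open import Data.Empty using (⊥-elim)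
open import Data.List using (List; []; _∷_; _++_; length; map; lookup; allFin; filter)
open import Data.List.Properties using (length-++; length-map)
open import Data.List.Relation.Unary.Any using (Any; here; there; index)
import Data.List.Relation.Unary.Any as Any
open import Data.List.Relation.Unary.Any.Properties using (lookup-index)
import Data.List.Relation.Unary.All as All
open import Data.List.Membership.Propositional using (_∈_)
open import Data.List.Membership.Propositional.Properties
  using (∈-++⁺ˡ; ∈-++⁺ʳ; ∈-map⁺; ∈-allFin; ∈-filter⁺; ∈-filter⁻)
open import Relation.Binary.Definitions using (tri<; tri≈; tri>)
open import Relation.Binary.PropositionalEquality
  using (_≡_; _≢_; refl; sym; trans; cong; cong₂; subst; module ≡-Reasoning)
open import Relation.Nullary using (¬_; Dec; yes; no)
open import Relation.Nullary.Decidable using (_×-dec_; _→-dec_; ¬?)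
open import Function using (_∘_; id)
open import Function.Bundles using (_⇔_; mk⇔)
open import Function.Definitions using (Injective)

injection-into-list : ∀ {n} {A : Set} (f : Fin n → A) (L : List A) →
  Injective _≡_ _≡_ f → (∀ a → f a ∈ L) → n ≤ length L
injection-into-list f L f-inj mem = injective⇒≤ position-injective
  where
  position-injective : Injective _≡_ _≡_ (λ a → index (mem a))
  position-injective {a} {b} e = f-inj (begin
    f a                     ≡⟨ lookup-index (mem a) ⟩
    lookup L (index (mem a)) ≡⟨ cong (lookup L) e ⟩
    lookup L (index (mem b)) ≡⟨ sym (lookup-index (mem b)) ⟩
    f b                     ∎)
    where open ≡-Reasoning

colourClass : ∀ {n} (f : Fin n → Bool) (b : Bool) → List (Fin n)
colourClass {zero} f b = []
colourClass {suc n} f true with f zero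
... | true  = zero ∷ map suc (colourClass (f ∘ suc) true)
... | false = map suc (colourClass (f ∘ suc) true)
colourClass {suc n} f false with f zero
... | true  = map suc (colourClass (f ∘ suc) false)
... | false = zero ∷ map suc (colourClass (f ∘ suc) false)

∈-colourClass : ∀ {n} (f : Fin n → Bool) b w → f w ≡ b → w ∈ colourClass f b
∈-colourClass {suc n} f true zero e with f zero
... | true = here refl
∈-colourClass {suc n} f false zero e with f zero
... | false = here refl
∈-colourClass {suc n} f true (suc w) e with f zero
... | true  = there (∈-map⁺ suc (∈-colourClass (f ∘ suc) true w e))
... | false = ∈-map⁺ suc (∈-colourClass (f ∘ suc) true w e)
∈-colourClass {suc n} f false (suc w) e with f zero
... | true  = ∈-map⁺ suc (∈-colourClass (f ∘ suc) false w e)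
... | false = there (∈-map⁺ suc (∈-colourClass (f ∘ suc) false w e))

length-colourClass : ∀ {n} (f : Fin n → Bool) b → length (colourClass f b) ≡ count f b
length-colourClass {zero} f b = refl
length-colourClass {suc n} f true with f zero
... | true  = cong suc (trans (length-map suc (colourClass (f ∘ suc) true)) (length-colourClass (f ∘ suc) true))
... | false = trans (length-map suc (colourClass (f ∘ suc) true)) (length-colourClass (f ∘ suc) true)
length-colourClass {suc n} f false with f zero
... | true  = trans (length-map suc (colourClass (f ∘ suc) false)) (length-colourClass (f ∘ suc) false)
... | false = cong suc (trans (length-map suc (colourClass (f ∘ suc) false)) (length-colourClass (f ∘ suc) false))

concatFin : ∀ {n} {X : Set} → (Fin n → List X) → List X
concatFin {zero} B = []
concatFin {suc n} B = B zero ++ concatFin (B ∘ suc)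

∈-concatFin : ∀ {n} {X : Set} (B : Fin n → List X) u {x} → x ∈ B u → x ∈ concatFin B
∈-concatFin {suc n} B zero p = ∈-++⁺ˡ p
∈-concatFin {suc n} B (suc u) p = ∈-++⁺ʳ (B zero) (∈-concatFin (B ∘ suc) u p)

length-concatFin : ∀ {n} {X : Set} (B : Fin n → List X) (f : Fin n → Bool) (g : Bool → ℕ) →
  (∀ u → length (B u) ≡ g (f u)) →
  length (concatFin B) ≡ count f true * g true + count f false * g false
length-concatFin {zero} B f g h = refl
length-concatFin {suc n} B f g h with f zero | h zero
... | true  | h0 = trans (length-++ (B zero))
  (trans (cong₂ _+_ h0 (length-concatFin (B ∘ suc) (f ∘ suc) g (h ∘ suc)))
         (regroup (g true) (count (f ∘ suc) true * g true) (count (f ∘ suc) false * g false)))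
  where
  regroup : ∀ x p q → x + (p + q) ≡ (x + p) + q
  regroup = solve-∀
... | false | h0 = trans (length-++ (B zero))
  (trans (cong₂ _+_ h0 (length-concatFin (B ∘ suc) (f ∘ suc) g (h ∘ suc)))
         (regroup (g false) (count (f ∘ suc) true * g true) (count (f ∘ suc) false * g false)))
  where
  regroup : ∀ x p q → x + (p + q) ≡ p + (x + q)
  regroup = solve-∀

cons : ∀ {n} {A : Set} → A → (Fin n → A) → Fin (suc n) → A
cons a f zero = a
cons a f (suc i) = f i

consAll : ∀ {n} {A : Set} → List A → List (Fin n → A) → List (Fin (suc n) → A)
consAll [] fs = []
consAll (a ∷ as) fs = map (cons a) fs ++ consAll as fs

∈-consAll : ∀ {n} {A : Set} {a : A} {as} {f : Fin n → A} {fs} →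
  a ∈ as → f ∈ fs → cons a f ∈ consAll as fs
∈-consAll {fs = fs} (here refl) f∈ = ∈-++⁺ˡ (∈-map⁺ _ f∈)
∈-consAll {as = b ∷ as} {fs = fs} (there a∈) f∈ = ∈-++⁺ʳ (map (cons b) fs) (∈-consAll a∈ f∈)

allFunctions : ∀ n {A : Set} → List A → List (Fin n → A)
allFunctions zero L = (λ ()) ∷ []
allFunctions (suc n) L = consAll L (allFunctions n L)

-- Without function extensionality, completeness is stated up to a pointwise
-- relation R: if each value of f is R-related to a member of L, so is f pointwise
-- to a member of allFunctions n L.
allFunctions-complete : ∀ n {A : Set} (L : List A) (R : A → A → Set) (f : Fin n → A) →
  (∀ x → Σ A λ a → a ∈ L × R a (f x)) →
  Σ (Fin n → A) λ g → g ∈ allFunctions n L × (∀ x → R (g x) (f x))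
allFunctions-complete zero L R f h = (λ ()) , here refl , λ ()
allFunctions-complete (suc n) L R f h
  with h zero | allFunctions-complete n L R (f ∘ suc) (h ∘ suc)
... | a , a∈ , Ra | g , g∈ , Rg = cons a g , ∈-consAll a∈ g∈ , λ { zero → Ra ; (suc x) → Rg x }

nothing≢just : ∀ {A : Set} {x : A} → nothing ≢ just x
nothing≢just ()

atMostOne⊎twoDistinct : ∀ n → n ≤ 1 ⊎ Σ (Fin n) λ a → Σ (Fin n) λ b → b ≢ a
atMostOne⊎twoDistinct zero = inj₁ z≤n
atMostOne⊎twoDistinct (suc zero) = inj₁ (s≤s z≤n)
atMostOne⊎twoDistinct (suc (suc n)) = inj₂ (zero , suc zero , λ ())

others : ∀ {n} → Fin n → Fin (pred n) → Fin n
others {suc n} x = punchIn x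

others-injective : ∀ {n} (x : Fin n) → Injective _≡_ _≡_ (others x)
others-injective {suc n} x = punchIn-injective x _ _

position : ∀ {n} (x a : Fin n) → a ≢ x → Fin (pred n)
position {suc n} x a a≢x = punchOut (a≢x ∘ sym)

others-position : ∀ {n} (x a : Fin n) (a≢x : a ≢ x) → others x (position x a a≢x) ≡ a
others-position {suc n} x a a≢x = punchIn-punchOut (a≢x ∘ sym)

position-irrelevant : ∀ {n} (x a : Fin n) (p q : a ≢ x) → position x a p ≡ position x a q
position-irrelevant {suc n} x a p q = punchOut-cong x refl

infixl 30 _∖_
_∖_ : (G : Graph) → Fin (order G) → Graph
G ∖ x = record
  { order = pred (order G)
  ; adj   = λ i j → adj G (others x i) (others x j)
  ; sym   = λ i j → Graph.sym G (others x i) (others x j)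
  ; irr   = λ i → irr G (others x i) }

∖-≼ : (G : Graph) (x : Fin (order G)) → G ∖ x ≼ G
∖-≼ G x = record { emb = others x ; emb-inj = others-injective x ; emb-adj = λ u v → refl }

∖-< : (G : Graph) (x : Fin (order G)) → order (G ∖ x) < order G
∖-< G x with order G
... | suc n = ℕ.≤-refl

adj-∖ : (G : Graph) (x a b : Fin (order G)) (a≢x : a ≢ x) (b≢x : b ≢ x) →
  adj G a b ≡ adj (G ∖ x) (position x a a≢x) (position x b b≢x)
adj-∖ G x a b a≢x b≢x = sym (cong₂ (adj G) (others-position x a a≢x) (others-position x b b≢x))

≼-trans : ∀ {A B C : Graph} → A ≼ B → B ≼ C → A ≼ C
≼-trans f g = record
  { emb     = _≼_.emb g ∘ _≼_.emb f
  ; emb-inj = _≼_.emb-inj f ∘ _≼_.emb-inj g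
  ; emb-adj = λ u v → trans (_≼_.emb-adj f u v) (_≼_.emb-adj g _ _) }

Twins : (G : Graph) → Fin (order G) → Fin (order G) → Set
Twins G x y = ∀ w → w ≢ x → w ≢ y → adj G x w ≡ adj G y w

symmetrize : ∀ {n} → (Fin n → Fin n → Bool) → Fin n → Fin n → Bool
symmetrize f u v with u <? v | v <? u
... | yes _ | _     = f u v
... | no _  | yes _ = f v u
... | no _  | no _  = false

symmetrize-sym : ∀ {n} (f : Fin n → Fin n → Bool) u v → symmetrize f u v ≡ symmetrize f v u
symmetrize-sym f u v with u <? v | v <? u
... | yes p | yes q = ⊥-elim (<-asym p q)
... | yes _ | no _  = refl
... | no _  | yes _ = refl
... | no _  | no _  = refl

symmetrize-irr : ∀ {n} (f : Fin n → Fin n → Bool) u → symmetrize f u u ≡ false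
symmetrize-irr f u with u <? u
... | yes p = ⊥-elim (<-irrefl refl p)
... | no _  = refl

symmetrize-cong : ∀ {n} (f g : Fin n → Fin n → Bool) → (∀ u v → f u v ≡ g u v) →
  ∀ u v → symmetrize f u v ≡ symmetrize g u v
symmetrize-cong f g e u v with u <? v | v <? u
... | yes _ | _     = e u v
... | no _  | yes _ = e v u
... | no _  | no _  = refl

symmetrize-adj : (G : Graph) → ∀ u v → symmetrize (adj G) u v ≡ adj G u v
symmetrize-adj G u v with u <? v | v <? u
... | yes _ | _     = refl
... | no _  | yes _ = Graph.sym G v u
... | no u≮v | no v≮u with <-cmp u v
...   | tri< u<v _ _ = ⊥-elim (u≮v u<v)
...   | tri> _ _ v<u = ⊥-elim (v≮u v<u)
...   | tri≈ _ refl _ = sym (irr G u)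

graphFrom : ∀ n → (Fin n → Fin n → Bool) → Graph
graphFrom n f = record
  { order = n ; adj = symmetrize f ; sym = symmetrize-sym f ; irr = symmetrize-irr f }

bools : List Bool
bools = true ∷ false ∷ []

∈-bools : ∀ b → b ∈ bools
∈-bools true = here refl
∈-bools false = there (here refl)

graphsOf : ℕ → List Graph
graphsOf n = map (graphFrom n) (allFunctions n (allFunctions n bools))

graphsOf-complete : (G : Graph) → Σ Graph λ F → F ∈ graphsOf (order G) × F ≼ G × G ≼ F
graphsOf-complete G
  with allFunctions-complete (order G) (allFunctions (order G) bools)
         (λ r s → ∀ v → r v ≡ s v) (adj G)
         (λ u → allFunctions-complete (order G) bools _≡_ (adj G u) (λ v → adj G u v , ∈-bools _ , refl))
... | g , g∈ , g≗adj = graphFrom (order G) g , ∈-map⁺ _ g∈ ,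
      record { emb = id ; emb-inj = id ; emb-adj = same-adj } ,
      record { emb = id ; emb-inj = id ; emb-adj = λ u v → sym (same-adj u v) }
  where
  same-adj : ∀ u v → symmetrize g u v ≡ adj G u v
  same-adj u v = trans (symmetrize-cong g (adj G) g≗adj u v) (symmetrize-adj G u v)

graphsUpTo : ℕ → List Graph
graphsUpTo zero = graphsOf zero
graphsUpTo (suc k) = graphsOf (suc k) ++ graphsUpTo k

∈-graphsUpTo : ∀ k n {F} → n ≤ k → F ∈ graphsOf n → F ∈ graphsUpTo k
∈-graphsUpTo zero .zero z≤n F∈ = F∈
∈-graphsUpTo (suc k) n n≤1+k F∈ with ℕ.m≤n⇒m<n∨m≡n n≤1+k
... | inj₁ (s≤s n≤k) = ∈-++⁺ʳ (graphsOf (suc k)) (∈-graphsUpTo k n n≤k F∈)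
... | inj₂ refl      = ∈-++⁺ˡ F∈

module _ (G0 : Graph) (inC : Fin (order G0) → Bool) where

  private
    M : ℕ
    M = order G0

  𝒢 : Graph → Set
  𝒢 = InClass G0 inC

  orderBound : ℕ
  orderBound = 4 * count inC true * count inC false + 2 * count inC true + 2 * count inC false + 1

  𝒢-hereditary : ∀ {F G} → F ≼ G → 𝒢 G → 𝒢 F
  𝒢-hereditary e c = record
    { φ      = φ ∘ emb
    ; same   = λ x y x≢y eq → trans (emb-adj x y) (same (emb x) (emb y) (x≢y ∘ emb-inj) eq)
    ; differ = λ x y ne → trans (emb-adj x y) (differ (emb x) (emb y) ne) }
    where
    open _≼_ e
    open InClass c

  record ModelAway (G : Graph) (x : Fin (order G)) (φ : Fin (order G) → Fin M) : Set where
    field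
      same   : ∀ a b → a ≢ x → b ≢ x → a ≢ b → φ a ≡ φ b → adj G a b ≡ inC (φ a)
      differ : ∀ a b → a ≢ x → b ≢ x → φ a ≢ φ b → adj G a b ≡ adj G0 (φ a) (φ b)

  extendLabel : ∀ {n} (x : Fin n) → (Fin (pred n) → Fin M) → Fin M → Fin n → Fin M
  extendLabel x ψ d a with a ≟ x
  ... | yes _   = d
  ... | no a≢x  = ψ (position x a a≢x)

  extendLabel-at : ∀ {n} (x : Fin n) ψ d → extendLabel x ψ d x ≡ d
  extendLabel-at x ψ d with x ≟ x
  ... | yes _   = refl
  ... | no x≢x  = ⊥-elim (x≢x refl)

  extendLabel-away : ∀ {n} (x a : Fin n) ψ d (a≢x : a ≢ x) →
    extendLabel x ψ d a ≡ ψ (position x a a≢x)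
  extendLabel-away x a ψ d a≢x with a ≟ x
  ... | yes a≡x  = ⊥-elim (a≢x a≡x)
  ... | no a≢x′  = cong ψ (position-irrelevant x a a≢x′ a≢x)

  extendLabel-indep : ∀ {n} (x a : Fin n) ψ d d′ → a ≢ x →
    extendLabel x ψ d a ≡ extendLabel x ψ d′ a
  extendLabel-indep x a ψ d d′ a≢x =
    trans (extendLabel-away x a ψ d a≢x) (sym (extendLabel-away x a ψ d′ a≢x))

  modelAway : (G : Graph) (x : Fin (order G)) (r : 𝒢 (G ∖ x)) (d : Fin M) →
    ModelAway G x (extendLabel x (InClass.φ r) d)
  modelAway G x r d = record { same = same′ ; differ = differ′ }
    where
    open InClass r
    open ≡-Reasoning
    φ′ = extendLabel x φ d
    pos : ∀ a → a ≢ x → Fin (pred (order G))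
    pos = position x
    label : ∀ a (a≢x : a ≢ x) → φ′ a ≡ φ (pos a a≢x)
    label a = extendLabel-away x a φ d

    same′ : ∀ a b → a ≢ x → b ≢ x → a ≢ b → φ′ a ≡ φ′ b → adj G a b ≡ inC (φ′ a)
    same′ a b a≢x b≢x a≢b eq = begin
      adj G a b                            ≡⟨ adj-∖ G x a b a≢x b≢x ⟩
      adj (G ∖ x) (pos a a≢x) (pos b b≢x) ≡⟨ same _ _ pos≢ (trans (sym (label a a≢x)) (trans eq (label b b≢x))) ⟩
      inC (φ (pos a a≢x))                  ≡⟨ cong inC (sym (label a a≢x)) ⟩
      inC (φ′ a)                           ∎
      where
      pos≢ : pos a a≢x ≢ pos b b≢x
      pos≢ e = a≢b (trans (sym (others-position x a a≢x))
                    (trans (cong (others x) e) (others-position x b b≢x)))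

    differ′ : ∀ a b → a ≢ x → b ≢ x → φ′ a ≢ φ′ b → adj G a b ≡ adj G0 (φ′ a) (φ′ b)
    differ′ a b a≢x b≢x ne = begin
      adj G a b                            ≡⟨ adj-∖ G x a b a≢x b≢x ⟩
      adj (G ∖ x) (pos a a≢x) (pos b b≢x) ≡⟨ differ _ _ (λ e → ne (trans (label a a≢x) (trans e (sym (label b b≢x))))) ⟩
      adj G0 (φ (pos a a≢x)) (φ (pos b b≢x)) ≡⟨ sym (cong₂ (adj G0) (label a a≢x) (label b b≢x)) ⟩
      adj G0 (φ′ a) (φ′ b)                 ∎

  -- Absorption: if φ is a model away from x, and x has a twin y ≠ x with
  -- φ x = φ y whose edge to x agrees with the type of the bag of y, then φ is a
  -- model of G (x simply joins the bag of y).
  absorbTwin : (G : Graph) (x y : Fin (order G)) (φ : Fin (order G) → Fin M) →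
    ModelAway G x φ → y ≢ x → Twins G x y → adj G x y ≡ inC (φ y) → φ x ≡ φ y → 𝒢 G
  absorbTwin G x y φ model y≢x twins xy-ok φx≡φy =
    record { φ = φ ; same = same′ ; differ = differ′ }
    where
    open ModelAway model
    open ≡-Reasoning

    sameAtX : ∀ b → b ≢ x → φ x ≡ φ b → adj G x b ≡ inC (φ x)
    sameAtX b b≢x eq with b ≟ y
    ... | yes refl = trans xy-ok (cong inC (sym φx≡φy))
    ... | no b≢y = begin
      adj G x b  ≡⟨ twins b b≢x b≢y ⟩
      adj G y b  ≡⟨ same y b y≢x b≢x (b≢y ∘ sym) (trans (sym φx≡φy) eq) ⟩
      inC (φ y)  ≡⟨ cong inC (sym φx≡φy) ⟩
      inC (φ x)  ∎

    differAtX : ∀ b → b ≢ x → φ x ≢ φ b → adj G x b ≡ adj G0 (φ x) (φ b)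
    differAtX b b≢x ne with b ≟ y
    ... | yes refl = ⊥-elim (ne φx≡φy)
    ... | no b≢y = begin
      adj G x b            ≡⟨ twins b b≢x b≢y ⟩
      adj G y b            ≡⟨ differ y b y≢x b≢x (ne ∘ trans φx≡φy) ⟩
      adj G0 (φ y) (φ b)   ≡⟨ cong (λ z → adj G0 z (φ b)) (sym φx≡φy) ⟩
      adj G0 (φ x) (φ b)   ∎

    same′ : ∀ a b → a ≢ b → φ a ≡ φ b → adj G a b ≡ inC (φ a)
    same′ a b a≢b eq with a ≟ x | b ≟ x
    ... | yes refl | yes refl = ⊥-elim (a≢b refl)
    ... | yes refl | no b≢x   = sameAtX b b≢x eq
    ... | no a≢x   | yes refl = trans (Graph.sym G a x) (trans (sameAtX a a≢x (sym eq)) (cong inC (sym eq)))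
    ... | no a≢x   | no b≢x   = same a b a≢x b≢x a≢b eq

    differ′ : ∀ a b → φ a ≢ φ b → adj G a b ≡ adj G0 (φ a) (φ b)
    differ′ a b ne with a ≟ x | b ≟ x
    ... | yes refl | yes refl = ⊥-elim (ne refl)
    ... | yes refl | no b≢x   = differAtX b b≢x ne
    ... | no a≢x   | yes refl = trans (Graph.sym G a x) (trans (differAtX a a≢x (ne ∘ sym)) (Graph.sym G0 (φ x) (φ a)))
    ... | no a≢x   | no b≢x   = differ a b a≢x b≢x ne

  Critical : Graph → Set
  Critical H = ¬ 𝒢 H × (∀ x → 𝒢 (H ∖ x))

  minimalForbidden⇒critical : ∀ H → MinimalForbidden G0 inC H → Critical H
  minimalForbidden⇒critical H mf = notIn , λ x → properIn (H ∖ x) (∖-≼ H x) (∖-< H x)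
    where open MinimalForbidden mf

  module CriticalBound {H : Graph} (critical : Critical H) where

    Φ : Fin (order H) → Fin M → Fin (order H) → Fin M
    Φ x = extendLabel x (InClass.φ (proj₂ critical x))

    Φ-model : ∀ x d → ModelAway H x (Φ x d)
    Φ-model x = modelAway H x (proj₂ critical x)

    -- (1) For twins x ≠ y, the edge xy disagrees with the type of y's bag in Φ x;
    -- otherwise x could join that bag (absorbTwin) and H would lie in 𝒢.
    twin-colour : ∀ x y d → y ≢ x → Twins H x y → inC (Φ x d y) ≢ adj H x y
    twin-colour x y d y≢x twins eq =
      proj₁ critical (absorbTwin H x y (Φ x dy) (Φ-model x dy) y≢x twins xy-ok x∼y)
      where
      dy = Φ x d y
      y-label : Φ x dy y ≡ dy
      y-label = extendLabel-indep x y _ dy d y≢x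
      xy-ok : adj H x y ≡ inC (Φ x dy y)
      xy-ok = trans (sym eq) (cong inC (sym y-label))
      x∼y : Φ x dy x ≡ Φ x dy y
      x∼y = trans (extendLabel-at x _ dy) (sym y-label)

    twin-separates : ∀ x y z d → y ≢ x → z ≢ x → y ≢ z → Twins H x y →
      adj H x z ≡ adj H x y → Φ x d y ≢ Φ x d z
    twin-separates x y z d y≢x z≢x y≢z twins xz≡xy eq = twin-colour x y d y≢x twins (begin
      inC (Φ x d y) ≡⟨ sym (ModelAway.same (Φ-model x d) y z y≢x z≢x y≢z eq) ⟩
      adj H y z     ≡⟨ sym (twins z z≢x (y≢z ∘ sym)) ⟩
      adj H x z     ≡⟨ xz≡xy ⟩
      adj H x y     ∎)
      where open ≡-Reasoning

    -- An injective coding of the vertices of H relative to a fixed vertex v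
    -- (d0 is an arbitrary label, needed to make Φ total).
    module Coding (v : Fin (order H)) (d0 : Fin M) where
      open ModelAway (Φ-model v d0)

      φv : Fin (order H) → Fin M
      φv = Φ v d0

      Key : Set
      Key = Fin M × Bool

      key : Fin (order H) → Key
      key a = φv a , adj H v a

      -- Two vertices other than v with equal key lie in a common bag of Φ v
      -- and have the same edge to v, so they are twins.
      equalKey⇒twins : ∀ a b → a ≢ v → b ≢ v → key a ≡ key b → Twins H a b
      equalKey⇒twins a b a≢v b≢v ka≡kb w w≢a w≢b with w ≟ v | Product.×-≡,≡←≡ ka≡kb
      ... | yes refl | _ , va≡vb = trans (Graph.sym H a v) (trans va≡vb (Graph.sym H v b))
      ... | no w≢v   | φa≡φb , _ with φv w ≟ φv a
      ...   | yes φw≡φa = trans (same a w a≢v w≢v (w≢a ∘ sym) (sym φw≡φa))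
                          (trans (cong inC φa≡φb)
                            (sym (same b w b≢v w≢v (w≢b ∘ sym) (trans (sym φa≡φb) (sym φw≡φa)))))
      ...   | no φw≢φa  = trans (differ a w a≢v w≢v (φw≢φa ∘ sym))
                          (trans (cong (λ z → adj G0 z (φv w)) φa≡φb)
                            (sym (differ b w b≢v w≢v (λ e → φw≢φa (sym (trans φa≡φb e))))))

      Member : Key → Fin (order H) → Set
      Member k a = a ≢ v × key a ≡ k

      member? : ∀ k a → Dec (Member k a)
      member? k a = ¬? (a ≟ v) ×-dec Product.≡-dec _≟_ Bool._≟_ (key a) k

      -- A representative of the key class k, chosen as a function of k alone.
      representative : (k : Key) → Dec (∃ (Member k))
      representative k = any? (member? k)

      member-adj : ∀ {k} a b → Member k a → Member k b → a ≢ b → adj H a b ≡ inC (proj₁ k)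
      member-adj a b (a≢v , refl) (b≢v , kb) a≢b =
        same a b a≢v b≢v a≢b (sym (cong proj₁ kb))

      tag : ∀ {k} → Dec (∃ (Member k)) → Fin (order H) → Maybe (Fin M)
      tag (no _) a = nothing
      tag (yes (r , _)) a with a ≟ r
      ... | yes _ = nothing
      ... | no _  = just (Φ r d0 a)

      tag-injective : ∀ {k} (c : Dec (∃ (Member k))) a b → Member k a → Member k b →
        tag c a ≡ tag c b → a ≡ b
      tag-injective (no none) a b ma mb e = ⊥-elim (none (a , ma))
      tag-injective (yes (r , mr)) a b ma mb e with a ≟ r | b ≟ r
      ... | yes refl | yes refl = refl
      ... | yes _    | no _     = ⊥-elim (nothing≢just e)
      ... | no _     | yes _    = ⊥-elim (nothing≢just (sym e))
      ... | no a≢r   | no b≢r with a ≟ b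
      ...   | yes a≡b = a≡b
      ...   | no a≢b  = ⊥-elim (twin-separates r a b d0 a≢r b≢r a≢b twins rb≡ra (just-injective e))
        where
        twins : Twins H r a
        twins = equalKey⇒twins r a (proj₁ mr) (proj₁ ma) (trans (proj₂ mr) (sym (proj₂ ma)))
        rb≡ra : adj H r b ≡ adj H r a
        rb≡ra = trans (member-adj r b mr mb (b≢r ∘ sym)) (sym (member-adj r a mr ma (a≢r ∘ sym)))

      allowedTags : Fin M → List (Maybe (Fin M))
      allowedTags u = nothing ∷ map just (colourClass inC (not (inC u)))

      tag-allowed : ∀ {k} (c : Dec (∃ (Member k))) a → Member k a → tag c a ∈ allowedTags (proj₁ k)
      tag-allowed (no _) a ma = here refl
      tag-allowed {k} (yes (r , mr)) a ma with a ≟ r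
      ... | yes _ = here refl
      ... | no a≢r = there (∈-map⁺ just (∈-colourClass inC _ (Φ r d0 a) opposite))
        where
        twins : Twins H r a
        twins = equalKey⇒twins r a (proj₁ mr) (proj₁ ma) (trans (proj₂ mr) (sym (proj₂ ma)))
        opposite : inC (Φ r d0 a) ≡ not (inC (proj₁ k))
        opposite = Bool.¬-not λ eq →
          twin-colour r a d0 a≢r twins (trans eq (sym (member-adj r a mr ma (a≢r ∘ sym))))

      Code : Set
      Code = Maybe (Key × Maybe (Fin M))

      code : Fin (order H) → Code
      code a with a ≟ v
      ... | yes _ = nothing
      ... | no _  = just (key a , tag (representative (key a)) a)

      code-injective : Injective _≡_ _≡_ code
      code-injective {a} {b} e with a ≟ v | b ≟ v
      ... | yes refl | yes refl = refl
      ... | yes _    | no _     = ⊥-elim (nothing≢just e)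
      ... | no _     | yes _    = ⊥-elim (nothing≢just (sym e))
      ... | no a≢v   | no b≢v   with Product.×-≡,≡←≡ (just-injective e)
      ...   | ka≡kb , tags≡ = tag-injective (representative (key a)) a b (a≢v , refl) (b≢v , sym ka≡kb)
                                (trans tags≡ (cong (λ k → tag (representative k) b) (sym ka≡kb)))

      keyBlock : Fin M → List Code
      keyBlock u = map (λ t → just ((u , true) , t)) (allowedTags u)
                ++ map (λ t → just ((u , false) , t)) (allowedTags u)

      codes : List Code
      codes = nothing ∷ concatFin keyBlock

      ∈-keyBlock : ∀ {u} b {t} → t ∈ allowedTags u → just ((u , b) , t) ∈ keyBlock u
      ∈-keyBlock true  t∈ = ∈-++⁺ˡ (∈-map⁺ _ t∈)
      ∈-keyBlock {u} false t∈ = ∈-++⁺ʳ (map (λ t → just ((u , true) , t)) (allowedTags u)) (∈-map⁺ _ t∈)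

      code∈codes : ∀ a → code a ∈ codes
      code∈codes a with a ≟ v
      ... | yes _  = here refl
      ... | no a≢v = there (∈-concatFin keyBlock (φv a)
                       (∈-keyBlock (adj H v a) (tag-allowed (representative (key a)) a (a≢v , refl))))

      blockSize : Bool → ℕ
      blockSize b = suc (count inC (not b)) + suc (count inC (not b))

      length-keyBlock : ∀ u → length (keyBlock u) ≡ blockSize (inC u)
      length-keyBlock u = begin
        length (keyBlock u)                           ≡⟨ length-++ (map _ (allowedTags u)) ⟩
        length (map _ (allowedTags u)) + length (map _ (allowedTags u))
          ≡⟨ cong₂ _+_ (length-map _ (allowedTags u)) (length-map _ (allowedTags u)) ⟩
        length (allowedTags u) + length (allowedTags u)
          ≡⟨ cong (λ n → suc n + suc n) (trans (length-map just (colourClass inC _)) (length-colourClass inC _)) ⟩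
        blockSize (inC u)                             ∎
        where open ≡-Reasoning

      length-codes : length codes ≡ orderBound
      length-codes = trans (cong suc (length-concatFin keyBlock inC blockSize length-keyBlock))
                           (count-identity (count inC true) (count inC false))
        where
        count-identity : ∀ c i → suc (c * (suc i + suc i) + i * (suc c + suc c)) ≡ 4 * c * i + 2 * c + 2 * i + 1
        count-identity = solve-∀

      order≤ : order H ≤ orderBound
      order≤ = subst (order H ≤_) length-codes (injection-into-list code codes code-injective code∈codes)

  critical-order≤ : ∀ {H} → Critical H → order H ≤ orderBound
  critical-order≤ {H} critical with atMostOne⊎twoDistinct (order H)
  ... | inj₁ n≤1 = ℕ.≤-trans n≤1 (ℕ.m≤n+m 1 _)
  ... | inj₂ (a , b , b≢a) = Coding.order≤ a (InClass.φ (proj₂ critical a) (position a b b≢a))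
    where open CriticalBound critical

  IsModel : (G : Graph) → (Fin (order G) → Fin M) → Set
  IsModel G φ = (∀ x y → x ≢ y → φ x ≡ φ y → adj G x y ≡ inC (φ x))
              × (∀ x y → φ x ≢ φ y → adj G x y ≡ adj G0 (φ x) (φ y))

  isModel? : (G : Graph) → ∀ φ → Dec (IsModel G φ)
  isModel? G φ =
    all? (λ x → all? (λ y → ¬? (x ≟ y) →-dec ((φ x ≟ φ y) →-dec (adj G x y Bool.≟ inC (φ x)))))
    ×-dec all? (λ x → all? (λ y → ¬? (φ x ≟ φ y) →-dec (adj G x y Bool.≟ adj G0 (φ x) (φ y))))

  IsModel-cong : (G : Graph) (c : 𝒢 G) (ψ : Fin (order G) → Fin M) →
    (∀ x → ψ x ≡ InClass.φ c x) → IsModel G ψ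
  IsModel-cong G c ψ ψ≗φ = same′ , differ′
    where
    open InClass c
    same′ : ∀ x y → x ≢ y → ψ x ≡ ψ y → adj G x y ≡ inC (ψ x)
    same′ x y x≢y eq =
      trans (same x y x≢y (trans (sym (ψ≗φ x)) (trans eq (ψ≗φ y)))) (cong inC (sym (ψ≗φ x)))
    differ′ : ∀ x y → ψ x ≢ ψ y → adj G x y ≡ adj G0 (ψ x) (ψ y)
    differ′ x y ne =
      trans (differ x y (λ e → ne (trans (ψ≗φ x) (trans e (sym (ψ≗φ y))))))
            (cong₂ (adj G0) (sym (ψ≗φ x)) (sym (ψ≗φ y)))

  𝒢? : (G : Graph) → Dec (𝒢 G)
  𝒢? G with Any.any? (isModel? G) (allFunctions (order G) (allFin M))
  ... | yes found with Any.satisfied found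
  ...   | φ , (same , differ) = yes (record { φ = φ ; same = same ; differ = differ })
  𝒢? G | no none = no λ c → none (listedModel c)
    where
    listedModel : 𝒢 G → Any (IsModel G) (allFunctions (order G) (allFin M))
    listedModel c
      with allFunctions-complete (order G) (allFin M) _≡_ (InClass.φ c) (λ x → _ , ∈-allFin _ , refl)
    ... | ψ , ψ∈ , ψ≗φ = Any.map (λ { refl → IsModel-cong G c ψ ψ≗φ }) ψ∈

  𝓕 : List Graph
  𝓕 = filter (λ F → ¬? (𝒢? F)) (graphsUpTo orderBound)

  𝒢⇒Forb : ∀ G → 𝒢 G → Forb 𝓕 G
  𝒢⇒Forb G c = All.tabulate λ F∈𝓕 F≼G →
    proj₂ (∈-filter⁻ (λ F → ¬? (𝒢? F)) {xs = graphsUpTo orderBound} F∈𝓕) (𝒢-hereditary F≼G c)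

  critical⇒¬Forb : ∀ {G} → Critical G → ¬ Forb 𝓕 G
  critical⇒¬Forb {G} critical free with graphsOf-complete G
  ... | F , F∈ , F≼G , G≼F = All.lookup free F∈𝓕 F≼G
    where
    F∈𝓕 : F ∈ 𝓕
    F∈𝓕 = ∈-filter⁺ (λ F → ¬? (𝒢? F))
            (∈-graphsUpTo orderBound (order G) (critical-order≤ critical) F∈)
            (λ F∈𝒢 → proj₁ critical (𝒢-hereditary G≼F F∈𝒢))

  -- Conversely every 𝓕-free graph lies in 𝒢, by induction on the order: its
  -- vertex deletions are 𝓕-free, hence in 𝒢, so it cannot be critical.
  Forb⇒𝒢 : ∀ k G → order G ≤ k → Forb 𝓕 G → 𝒢 G
  Forb⇒𝒢 k G order≤k free with 𝒢? G
  ... | yes G∈𝒢 = G∈𝒢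
  ... | no G∉𝒢 = ⊥-elim (critical⇒¬Forb (G∉𝒢 , deletions k order≤k) free)
    where
    deletions : ∀ m → order G ≤ m → ∀ x → 𝒢 (G ∖ x)
    deletions zero order≤0 x = ⊥-elim (ℕ.n≮0 (ℕ.<-≤-trans (toℕ<n x) order≤0))
    deletions (suc m) order≤1+m x =
      Forb⇒𝒢 m (G ∖ x) (ℕ.pred-mono-≤ order≤1+m) (All.map (λ F⋠G F≼G∖x → F⋠G (≼-trans F≼G∖x (∖-≼ G x))) free)

theorem1 : (G0 : Graph) (inC : Fin (order G0) → Bool) →
    ((H : Graph) → MinimalForbidden G0 inC H →
    order H ≤ 4 * count inC true * count inC false + 2 * count inC true + 2 * count inC false + 1)
    × Σ (List Graph) (λ 𝓕 → (G : Graph) → InClass G0 inC G ⇔ Forb 𝓕 G)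
theorem1 G0 inC =
    (λ H minimal → critical-order≤ G0 inC (minimalForbidden⇒critical G0 inC H minimal))
  , 𝓕 G0 inC
  , λ G → mk⇔ (𝒢⇒Forb G0 inC G) (Forb⇒𝒢 G0 inC (order G) G ℕ.≤-refl)
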